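{- Fix integers $a$ and $b$ with $1\le b\le a/2$, and let $\lambda=\langle a-1,a-3,\dots,a-(2b-1)\rangle$. Then the number of partitions with distinct parts contained in the shifted Ferrers shape $\lambda$ (including the empty partition) equals $\binom{a}{b}$.
   Context: For a partition with distinct parts $\lambda=\langle \lambda_1,\dots,\lambda_b\rangle$ (with $\lambda_1>\dots>\lambda_b\ge 1$), a partition $\mu$ is contained in the shifted Ferrers shape $\lambda$ if $\mu=\langle\mu_1,\dots,\mu_k\rangle$ has distinct parts, $k\le b$, and $\mu_i\le\lambda_i$ for all $i\le k$. -}

module Defs where

open import Data.Nat using (ℕ; zero; suc; _+_; _*_; _∸_; _≤_; _<_; _>_)
open import Data.List using (List; []; _∷_; map; upTo; length)
open import Data.List.Relation.Unary.Unique.Propositional using (Unique)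
open import Data.List.Membership.Propositional using (_∈_)
open import Data.Product using (Σ; _×_)
open import Function.Bundles using (_⇔_)
open import Relation.Binary.PropositionalEquality using (_≡_)

data DistinctParts : List ℕ → Set where
  []  : DistinctParts []
  [_] : ∀ {m} → 1 ≤ m → DistinctParts (m ∷ [])
  _∷_ : ∀ {m n μ} → m > n → DistinctParts (n ∷ μ) → DistinctParts (m ∷ n ∷ μ)

data FitsUnder : List ℕ → List ℕ → Set where
  []  : ∀ {λs} → FitsUnder [] λs
  _∷_ : ∀ {m l μ λs} → m ≤ l → FitsUnder μ λs → FitsUnder (m ∷ μ) (l ∷ λs)

-- μ is contained in the shifted Ferrers shape λ (λ itself a distinct-part partition).
ContainedIn : List ℕ → List ℕ → Set
ContainedIn μ λs = DistinctParts μ × FitsUnder μ λs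

shape : ℕ → ℕ → List ℕ
shape a b = map (λ i → a ∸ (2 * i + 1)) (upTo b)

HasCount : (List ℕ → Set) → ℕ → Set
HasCount P n = Σ (List (List ℕ)) λ xs → Unique xs × (∀ μ → (μ ∈ xs ⇔ P μ)) × length xs ≡ n

-- Let N(c, b) count the partitions contained in ⟨c+2b−1, …, c+3, c+1⟩, the shape for
-- a = c + 2b. Deleting the first column of such a partition (subtracting 1 from every part)
-- is a bijection onto the partitions contained in ⟨c+2b−2, …, c+2, c⟩ for those without a
-- part 1, and onto the partitions contained in ⟨c+2b−2, …, c+2⟩ for those with one. Hence
-- N(c, b) = N(c−1, b) + N(c+1, b−1), which is Pascal's rule for C(c+2b, b). For c = 0 the
-- last row of the first shape is empty, so both terms are N(1, b−1) = C(2b−1, b−1), and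
-- symmetry of binomial coefficients closes the recursion.
module Submission where

open import Defs
open import Data.Nat using (ℕ; zero; suc; _+_; _*_; _∸_; _≤_; _<_; z≤n; s≤s)
open import Data.Nat.Properties using (suc-injective; <-trans; <⇒≱; m≤m+n; m+n∸m≡n; m+n∸n≡m; m∸n+n≡m)
open import Data.Nat.Tactic.RingSolver using (solve-∀)
open import Data.Nat.Combinatorics using (_C_; nCk≡nC[n∸k]; nCk+nC[k+1]≡[n+1]C[k+1])
open import Data.List using (List; []; _∷_; _++_; _∷ʳ_; map; upTo)
open import Data.List.Properties using (map-++; map-injective; ∷-injectiveʳ; ∷ʳ-injective; upTo-∷ʳ; length-++; length-map)
open import Data.List.Relation.Unary.All using (All; []; _∷_)
open import Data.List.Relation.Unary.Any using (here; there)
import Data.List.Relation.Unary.Unique.Propositional.Properties as Unique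
open import Data.List.Relation.Unary.AllPairs using ([]; _∷_)
open import Data.List.Membership.Propositional using (_∈_)
open import Data.List.Membership.Propositional.Properties using (∈-map⁺; ∈-map⁻; ∈-++⁺ˡ; ∈-++⁺ʳ; ∈-++⁻)
open import Data.Product using (Σ-syntax; _×_; _,_)
open import Data.Sum using (_⊎_; inj₁; inj₂; [_,_]′)
open import Data.Empty using (⊥-elim)
open import Function using (_∘_)
open import Function.Bundles using (_⇔_; mk⇔; Equivalence)
open import Function.Definitions using (Injective)
open import Function.Construct.Symmetry using (⇔-sym)
open import Relation.Binary.PropositionalEquality using (_≡_; _≢_; refl; sym; trans; cong; cong₂; subst; subst₂; module ≡-Reasoning)
open import Relation.Nullary using (¬_)

open Equivalence using (to; from)

Image : (List ℕ → List ℕ) → (List ℕ → Set) → List ℕ → Set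
Image f P μ = Σ[ ν ∈ List ℕ ] P ν × μ ≡ f ν

HasCount-cong : ∀ {P Q n} → (∀ μ → P μ ⇔ Q μ) → HasCount P n → HasCount Q n
HasCount-cong P⇔Q (xs , unique , ∈⇔P , len) =
  xs , unique , (λ μ → mk⇔ (to (P⇔Q μ) ∘ to (∈⇔P μ)) (from (∈⇔P μ) ∘ from (P⇔Q μ))) , len

HasCount-≡ : ∀ ν → HasCount (_≡ ν) 1
HasCount-≡ ν = ν ∷ [] , [] ∷ [] , (λ μ → mk⇔ (λ { (here μ≡ν) → μ≡ν ; (there ()) }) here) , refl

HasCount-image : ∀ {P n} {f : List ℕ → List ℕ} → Injective _≡_ _≡_ f →
                 HasCount P n → HasCount (Image f P) n
HasCount-image {f = f} f-inj (xs , unique , ∈⇔P , len) =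
  map f xs , Unique.map⁺ f-inj unique , ∈⇔Image , trans (length-map f xs) len
  where
  ∈⇔Image : ∀ μ → μ ∈ map f xs ⇔ Image f _ μ
  ∈⇔Image μ = mk⇔
    (λ μ∈ → let ν , ν∈ , μ≡fν = ∈-map⁻ f μ∈ in ν , to (∈⇔P ν) ν∈ , μ≡fν)
    (λ { (ν , Pν , refl) → ∈-map⁺ f (from (∈⇔P ν) Pν) })

HasCount-⊎ : ∀ {P Q n m} → (∀ {μ} → P μ → ¬ Q μ) →
             HasCount P n → HasCount Q m → HasCount (λ μ → P μ ⊎ Q μ) (n + m)
HasCount-⊎ {P} {Q} P⇒¬Q (xs , xs-unique , ∈⇔P , xs-len) (ys , ys-unique , ∈⇔Q , ys-len) =
  xs ++ ys , Unique.++⁺ xs-unique ys-unique disjoint , ∈⇔P⊎Q ,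
  trans (length-++ xs) (cong₂ _+_ xs-len ys-len)
  where
  disjoint : ∀ {μ} → ¬ (μ ∈ xs × μ ∈ ys)
  disjoint {μ} (μ∈xs , μ∈ys) = P⇒¬Q (to (∈⇔P μ) μ∈xs) (to (∈⇔Q μ) μ∈ys)
  ∈⇔P⊎Q : ∀ μ → μ ∈ xs ++ ys ⇔ (P μ ⊎ Q μ)
  ∈⇔P⊎Q μ = mk⇔
    ([ inj₁ ∘ to (∈⇔P μ) , inj₂ ∘ to (∈⇔Q μ) ]′ ∘ ∈-++⁻ xs)
    [ ∈-++⁺ˡ ∘ from (∈⇔P μ) , ∈-++⁺ʳ xs ∘ from (∈⇔Q μ) ]′

suc-∷ʳ1 : List ℕ → List ℕ
suc-∷ʳ1 ν = map suc ν ∷ʳ 1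

suc-∷ʳ1-injective : Injective _≡_ _≡_ suc-∷ʳ1
suc-∷ʳ1-injective {ν} {ν′} eq with ∷ʳ-injective (map suc ν) (map suc ν′) eq
... | eq′ , _ = map-injective suc-injective eq′

DistinctParts⇒positive : ∀ {μ} → DistinctParts μ → All (0 <_) μ
DistinctParts⇒positive []         = []
DistinctParts⇒positive [ m>0 ]      = m>0 ∷ []
DistinctParts⇒positive (m>n ∷ ds) with DistinctParts⇒positive ds
... | n>0 ∷ ps = <-trans n>0 m>n ∷ n>0 ∷ ps

map-suc-positive≢suc-∷ʳ1 : ∀ {ν} ν′ → All (0 <_) ν → map suc ν ≢ suc-∷ʳ1 ν′
map-suc-positive≢suc-∷ʳ1 {_ ∷ []}    []       (() ∷ _) refl
map-suc-positive≢suc-∷ʳ1 {_ ∷ _ ∷ _} []       _        ()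
map-suc-positive≢suc-∷ʳ1 {_ ∷ ν}     (_ ∷ ν′) (_ ∷ ps) eq =
  map-suc-positive≢suc-∷ʳ1 ν′ ps (∷-injectiveʳ eq)

DistinctParts-map-suc : ∀ {ν} → DistinctParts ν → DistinctParts (map suc ν)
DistinctParts-map-suc []         = []
DistinctParts-map-suc [ _ ]      = [ s≤s z≤n ]
DistinctParts-map-suc (m>n ∷ ds) = s≤s m>n ∷ DistinctParts-map-suc ds

DistinctParts-suc-∷ʳ1 : ∀ {ν} → DistinctParts ν → DistinctParts (suc-∷ʳ1 ν)
DistinctParts-suc-∷ʳ1 []         = [ s≤s z≤n ]
DistinctParts-suc-∷ʳ1 [ n>0 ]    = s≤s n>0 ∷ [ s≤s z≤n ]
DistinctParts-suc-∷ʳ1 (m>n ∷ ds) = s≤s m>n ∷ DistinctParts-suc-∷ʳ1 ds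

DistinctParts-peel : ∀ {μ} → DistinctParts μ →
                     Image (map suc) DistinctParts μ ⊎ Image suc-∷ʳ1 DistinctParts μ
DistinctParts-peel []                    = inj₁ ([] , [] , refl)
DistinctParts-peel ([_] {suc zero} _)    = inj₂ ([] , [] , refl)
DistinctParts-peel ([_] {suc (suc m)} _) = inj₁ (suc m ∷ [] , [ s≤s z≤n ] , refl)
DistinctParts-peel (s≤s m>n ∷ ds) with DistinctParts-peel ds
... | inj₁ (_ ∷ _ , ds′ , refl) = inj₁ (_ ∷ _ , m>n ∷ ds′ , refl)
... | inj₂ ([]    , _   , refl) = inj₂ (_ ∷ [] , [ m>n ] , refl)
... | inj₂ (_ ∷ _ , ds′ , refl) = inj₂ (_ ∷ _ , m>n ∷ ds′ , refl)

FitsUnder-map-suc⁺ : ∀ {ν L} → FitsUnder ν L → FitsUnder (map suc ν) (map suc L)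
FitsUnder-map-suc⁺ []        = []
FitsUnder-map-suc⁺ (n≤l ∷ f) = s≤s n≤l ∷ FitsUnder-map-suc⁺ f

FitsUnder-map-suc⁻ : ∀ ν {L} → FitsUnder (map suc ν) (map suc L) → FitsUnder ν L
FitsUnder-map-suc⁻ []      _             = []
FitsUnder-map-suc⁻ (_ ∷ ν) {_ ∷ _} (s≤s n≤l ∷ f) = n≤l ∷ FitsUnder-map-suc⁻ ν f

FitsUnder-suc-∷ʳ1⁺ : ∀ {ν L l} → FitsUnder ν L → FitsUnder (suc-∷ʳ1 ν) (map suc (L ∷ʳ l))
FitsUnder-suc-∷ʳ1⁺ {L = []}    []        = s≤s z≤n ∷ []
FitsUnder-suc-∷ʳ1⁺ {L = _ ∷ _} []        = s≤s z≤n ∷ []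
FitsUnder-suc-∷ʳ1⁺             (n≤l ∷ f) = s≤s n≤l ∷ FitsUnder-suc-∷ʳ1⁺ f

FitsUnder-suc-∷ʳ1⁻ : ∀ ν {L l} → FitsUnder (suc-∷ʳ1 ν) (map suc (L ∷ʳ l)) → FitsUnder ν L
FitsUnder-suc-∷ʳ1⁻ []          _             = []
FitsUnder-suc-∷ʳ1⁻ (_ ∷ [])    {[]}    (_ ∷ ())
FitsUnder-suc-∷ʳ1⁻ (_ ∷ _ ∷ _) {[]}    (_ ∷ ())
FitsUnder-suc-∷ʳ1⁻ (_ ∷ ν)     {_ ∷ _} (s≤s n≤l ∷ f) = n≤l ∷ FitsUnder-suc-∷ʳ1⁻ ν f

FitsUnder-++ : ∀ {μ L} L′ → FitsUnder μ L → FitsUnder μ (L ++ L′)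
FitsUnder-++ _  []        = []
FitsUnder-++ L′ (m≤l ∷ f) = m≤l ∷ FitsUnder-++ L′ f

FitsUnder-∷ʳ0⁻ : ∀ {μ L} → All (0 <_) μ → FitsUnder μ (L ∷ʳ 0) → FitsUnder μ L
FitsUnder-∷ʳ0⁻ {L = []}    (m>0 ∷ _)  (m≤0 ∷ _) = ⊥-elim (<⇒≱ m>0 m≤0)
FitsUnder-∷ʳ0⁻             []         []        = []
FitsUnder-∷ʳ0⁻ {L = _ ∷ _} (_ ∷ ps)   (m≤l ∷ f) = m≤l ∷ FitsUnder-∷ʳ0⁻ ps f

ContainedIn-[] : ∀ μ → ContainedIn μ [] ⇔ μ ≡ []
ContainedIn-[] μ = mk⇔ (λ { (_ , []) → refl }) (λ { refl → [] , [] })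

ContainedIn-∷ʳ0 : ∀ L μ → ContainedIn μ (L ∷ʳ 0) ⇔ ContainedIn μ L
ContainedIn-∷ʳ0 L μ = mk⇔
  (λ (ds , f) → ds , FitsUnder-∷ʳ0⁻ (DistinctParts⇒positive ds) f)
  (λ (ds , f) → ds , FitsUnder-++ (0 ∷ []) f)

ContainedIn-map-suc-∷ʳ : ∀ L l μ →
  ContainedIn μ (map suc (L ∷ʳ l)) ⇔
  (Image suc-∷ʳ1 (λ ν → ContainedIn ν L) μ ⊎ Image (map suc) (λ ν → ContainedIn ν (L ∷ʳ l)) μ)
ContainedIn-map-suc-∷ʳ L l μ = mk⇔ peel unpeel
  where
  peel : ContainedIn μ (map suc (L ∷ʳ l)) →
         Image suc-∷ʳ1 (λ ν → ContainedIn ν L) μ ⊎ Image (map suc) (λ ν → ContainedIn ν (L ∷ʳ l)) μ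
  peel (ds , f) with DistinctParts-peel ds
  ... | inj₁ (ν , ds′ , refl) = inj₂ (ν , (ds′ , FitsUnder-map-suc⁻ ν f) , refl)
  ... | inj₂ (ν , ds′ , refl) = inj₁ (ν , (ds′ , FitsUnder-suc-∷ʳ1⁻ ν f) , refl)
  unpeel : Image suc-∷ʳ1 (λ ν → ContainedIn ν L) μ ⊎ Image (map suc) (λ ν → ContainedIn ν (L ∷ʳ l)) μ →
           ContainedIn μ (map suc (L ∷ʳ l))
  unpeel (inj₁ (_ , (ds , f) , refl)) = DistinctParts-suc-∷ʳ1 ds , FitsUnder-suc-∷ʳ1⁺ f
  unpeel (inj₂ (_ , (ds , f) , refl)) = DistinctParts-map-suc ds , FitsUnder-map-suc⁺ f

ContainedCount : List ℕ → ℕ → Set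
ContainedCount L = HasCount (λ μ → ContainedIn μ L)

containedCount-[] : ContainedCount [] 1
containedCount-[] = HasCount-cong (λ μ → ⇔-sym (ContainedIn-[] μ)) (HasCount-≡ [])

containedCount-∷ʳ0 : ∀ {L n} → ContainedCount L n → ContainedCount (L ∷ʳ 0) n
containedCount-∷ʳ0 {L} = HasCount-cong (λ μ → ⇔-sym (ContainedIn-∷ʳ0 L μ))

containedCount-map-suc-∷ʳ : ∀ {L l m n} → ContainedCount L m → ContainedCount (L ∷ʳ l) n →
                            ContainedCount (map suc (L ∷ʳ l)) (m + n)
containedCount-map-suc-∷ʳ {L} {l} countL countL∷ʳl =
  HasCount-cong (λ μ → ⇔-sym (ContainedIn-map-suc-∷ʳ L l μ))
    (HasCount-⊎ disjoint (HasCount-image suc-∷ʳ1-injective countL)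
                         (HasCount-image (map-injective suc-injective) countL∷ʳl))
  where
  disjoint : ∀ {μ} → Image suc-∷ʳ1 (λ ν → ContainedIn ν L) μ → ¬ Image (map suc) (λ ν → ContainedIn ν (L ∷ʳ l)) μ
  disjoint (ν , _ , refl) (ν′ , (ds , _) , eq) =
    map-suc-positive≢suc-∷ʳ1 ν (DistinctParts⇒positive ds) (sym eq)

-- stair c b = ⟨c+2b−1, …, c+3, c+1⟩
stair : ℕ → ℕ → List ℕ
stair c zero    = []
stair c (suc b) = stair (2 + c) b ∷ʳ suc c

stair-suc : ∀ c b → stair (suc c) b ≡ map suc (stair c b)
stair-suc c zero    = refl
stair-suc c (suc b) = begin
  stair (3 + c) b ∷ʳ (2 + c)             ≡⟨ cong (_∷ʳ (2 + c)) (stair-suc (2 + c) b) ⟩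
  map suc (stair (2 + c) b) ∷ʳ (2 + c)   ≡⟨ map-++ suc (stair (2 + c) b) (suc c ∷ []) ⟨
  map suc (stair c (suc b))              ∎
  where open ≡-Reasoning

stair-unfold : ∀ c b → stair c (suc b) ≡ map suc (stair (suc c) b ∷ʳ c)
stair-unfold c b = begin
  stair (2 + c) b ∷ʳ suc c             ≡⟨ cong (_∷ʳ suc c) (stair-suc (suc c) b) ⟩
  map suc (stair (suc c) b) ∷ʳ suc c   ≡⟨ map-++ suc (stair (suc c) b) (c ∷ []) ⟨
  map suc (stair (suc c) b ∷ʳ c)       ∎
  where open ≡-Reasoning

c+2[1+b]≡2+c+2b : ∀ c b → c + 2 * suc b ≡ 2 + c + 2 * b
c+2[1+b]≡2+c+2b = solve-∀

shape-stair : ∀ c b → shape (c + 2 * b) b ≡ stair c b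
shape-stair c zero    = refl
shape-stair c (suc b) = begin
  map gap (upTo (suc b))               ≡⟨ cong (map gap) (upTo-∷ʳ b) ⟨
  map gap (upTo b ∷ʳ b)                ≡⟨ map-++ gap (upTo b) (b ∷ []) ⟩
  shape (c + 2 * suc b) b ∷ʳ gap b     ≡⟨ cong₂ (λ a x → shape a b ∷ʳ x) (c+2[1+b]≡2+c+2b c b) last-gap ⟩
  shape (2 + c + 2 * b) b ∷ʳ suc c     ≡⟨ cong (_∷ʳ suc c) (shape-stair (2 + c) b) ⟩
  stair (2 + c) b ∷ʳ suc c             ∎
  where
  open ≡-Reasoning
  gap : ℕ → ℕ
  gap i = c + 2 * suc b ∸ (2 * i + 1)
  last-gap : gap b ≡ suc c
  last-gap = trans (cong (_∸ (2 * b + 1)) (c+2[1+b]≡1+c+[2b+1] c b)) (m+n∸n≡m (suc c) (2 * b + 1))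
    where
    c+2[1+b]≡1+c+[2b+1] : ∀ c b → c + 2 * suc b ≡ suc c + (2 * b + 1)
    c+2[1+b]≡1+c+[2b+1] = solve-∀

containedCount-stair-step : ∀ b c →
  ContainedCount (stair (suc c) b) ((suc c + 2 * b) C b) →
  ContainedCount (stair (suc c) b ∷ʳ c) ((suc c + 2 * b) C suc b) →
  ContainedCount (stair c (suc b)) ((c + 2 * suc b) C suc b)
containedCount-stair-step b c count count∷ʳc =
  subst₂ ContainedCount (sym (stair-unfold c b)) pascal (containedCount-map-suc-∷ʳ count count∷ʳc)
  where
  pascal : (suc c + 2 * b) C b + (suc c + 2 * b) C suc b ≡ (c + 2 * suc b) C suc b
  pascal = trans (nCk+nC[k+1]≡[n+1]C[k+1] (suc c + 2 * b) b) (cong (_C suc b) (sym (c+2[1+b]≡2+c+2b c b)))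

[1+2b]Cb≡[1+2b]C[1+b] : ∀ b → (1 + 2 * b) C b ≡ (1 + 2 * b) C suc b
[1+2b]Cb≡[1+2b]C[1+b] b =
  trans (nCk≡nC[n∸k] (subst (b ≤_) (sym (1+2b≡b+[1+b] b)) (m≤m+n b (suc b))))
        (cong ((1 + 2 * b) C_) (trans (cong (_∸ b) (1+2b≡b+[1+b] b)) (m+n∸m≡n b (suc b))))
  where
  1+2b≡b+[1+b] : ∀ b → 1 + 2 * b ≡ b + suc b
  1+2b≡b+[1+b] = solve-∀

containedCount-stair : ∀ b c → ContainedCount (stair c b) ((c + 2 * b) C b)
containedCount-stair zero    c       = containedCount-[]
containedCount-stair (suc b) zero    =
  containedCount-stair-step b 0 (containedCount-stair b 1)
    (subst (ContainedCount (stair 1 b ∷ʳ 0)) ([1+2b]Cb≡[1+2b]C[1+b] b)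
      (containedCount-∷ʳ0 (containedCount-stair b 1)))
containedCount-stair (suc b) (suc c) =
  containedCount-stair-step b (suc c) (containedCount-stair b (2 + c))
    (subst (ContainedCount (stair c (suc b))) (cong (_C suc b) (c+2[1+b]≡2+c+2b c b))
      (containedCount-stair (suc b) c))

containedCount-shape : ∀ c b → ContainedCount (shape (c + 2 * b) b) ((c + 2 * b) C b)
containedCount-shape c b =
  subst (λ L → ContainedCount L ((c + 2 * b) C b)) (sym (shape-stair c b)) (containedCount-stair b c)

proposition3p2 : (a b : ℕ) → 1 ≤ b → 2 * b ≤ a → HasCount (λ μ → ContainedIn μ (shape a b)) (a C b)
proposition3p2 a b _ 2b≤a =
  subst (λ a → ContainedCount (shape a b) (a C b)) (m∸n+n≡m 2b≤a) (containedCount-shape (a ∸ 2 * b) b)
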